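{- Let $G$ be a finite simple graph with independence polynomial $I_G(t)=\sum_{j=0}^{\alpha(G)} i_j t^j$, and let $Y_G=\sum_{\alpha:V(G)\to\mathbb{N}} X_G^{\alpha}$. Then for every $1\le k\le \alpha(G)-1$, the coefficient $[s_{(k,k)}]Y_G$ is nonnegative if and only if $i_k^2\ge i_{k-1}i_{k+1}$.
   Context: $i_j$ is the number of independent sets of size $j$ in $G$, $\alpha(G)$ the independence number. $\mathbb{N}=\{0,1,2,\dots\}$. For $\alpha:V(G)\to\mathbb{N}$, a proper multicoloring of type $\alpha$ is a map $\kappa$ from $V(G)$ to finite subsets of the positive integers with $|\kappa(v)|=\alpha(v)$ for all $v$ and $\kappa(u)\cap\kappa(v)=\emptyset$ for every edge $uv$. Stanley's normalized chromatic symmetric function is $X_G^{\alpha}=\sum_\kappa x_1^{a_1}x_2^{a_2}\cdots$, summed over proper multicolorings $\kappa$ of type $\alpha$, where $a_i=\#\{v: i\in\kappa(v)\}$. $Y_G$ is an inhomogeneous symmetric function (it equals $\prod_{i\ge1} I_G(x_i)$), and $[s_\lambda]f$ denotes the coefficient of the Schur function $s_\lambda$ in the Schur expansion of $f$. -}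

module Defs where

open import Data.Bool using (Bool; true; false; _∧_; not; if_then_else_)
open import Data.Nat using (ℕ; zero; suc; _+_; _≡ᵇ_; _≤ᵇ_; _<ᵇ_; _∸_; _⊔_)
open import Data.Integer as ℤ using (ℤ; +_)
open import Data.Fin using (Fin)
open import Data.Fin.Subset using (Subset; ∣_∣)
open import Data.Vec as Vec using (Vec; []; _∷_; lookup)
open import Data.List as List using (List; []; _∷_; map; concatMap; length; filterᵇ; foldr; downFrom; zip)
open import Data.Maybe using (Maybe; just; nothing)
open import Relation.Binary.PropositionalEquality using (_≡_)

all : {A : Set} → (A → Bool) → List A → Bool
all p []       = true
all p (x ∷ xs) = p x ∧ all p xs

record Graph (n : ℕ) : Set where
  field
    Adj    : Fin n → Fin n → Bool
    irrefl : ∀ v → Adj v v ≡ false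
    sym    : ∀ u v → Adj u v ≡ Adj v u
open Graph public

allSubsets : (m : ℕ) → List (Subset m)
allSubsets zero    = [] ∷ []
allSubsets (suc m) = map (true ∷_) (allSubsets m) List.++ map (false ∷_) (allSubsets m)

allVecs : {A : Set} → List A → (n : ℕ) → List (Vec A n)
allVecs xs zero    = [] ∷ []
allVecs xs (suc n) = concatMap (λ x → map (x ∷_) (allVecs xs n)) xs

vertices : (n : ℕ) → List (Fin n)
vertices n = Vec.toList (Vec.allFin n)

isIndependent : ∀ {n} → Graph n → Subset n → Bool
isIndependent {n} G S =
  all (λ u → all (λ v → not (lookup S u ∧ lookup S v ∧ Adj G u v)) (vertices n)) (vertices n)

independentSets : ∀ {n} → Graph n → List (Subset n)
independentSets {n} G = filterᵇ (isIndependent G) (allSubsets n)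

indepCount : ∀ {n} → Graph n → ℕ → ℕ
indepCount G j = length (filterᵇ (λ S → ∣ S ∣ ≡ᵇ j) (independentSets G))

independenceNumber : ∀ {n} → Graph n → ℕ
independenceNumber G = foldr _⊔_ 0 (map ∣_∣ (independentSets G))

-- A multicoloring using only the colors 1..m (represented by Fin m) is
-- κ : Vec (Subset m) n, κ(v) being the set of colors of v (its type is
-- α(v) = |κ(v)|; all types are allowed since Y_G sums over all α).

isProper : ∀ {n m} → Graph n → Vec (Subset m) n → Bool
isProper {n} {m} G κ =
  all (λ u → all (λ v → not (Adj G u v) Data.Bool.∨
                   all (λ c → not (lookup (lookup κ u) c ∧ lookup (lookup κ v) c)) (vertices m))
                 (vertices n))
      (vertices n)
  where import Data.Bool

exponent : ∀ {n m} → Vec (Subset m) n → Fin m → ℕ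
exponent κ c = List.length (filterᵇ (λ S → lookup S c) (Vec.toList κ))

eqVec : ∀ {m} → Vec ℕ m → Vec ℕ m → Bool
eqVec []       []       = true
eqVec (x ∷ xs) (y ∷ ys) = (x ≡ᵇ y) ∧ eqVec xs ys

-- coefficient of the monomial x_1^{a_1} ... x_m^{a_m} (all other
-- variables to the power 0) in Y_G, where a = (a_1,...,a_m)
YCoeff : ∀ {n} → Graph n → List ℕ → ℕ
YCoeff {n} G a =
  length (filterᵇ
    (λ κ → isProper G κ ∧ eqVec (Vec.tabulate (exponent κ)) (Vec.fromList a))
    (allVecs (allSubsets (length a)) n))

-- Schur coefficients of a symmetric function given by its monomial
-- coefficients  f : List ℕ → ℤ  (f a = [x_1^{a_1}...x_m^{a_m}] f).
-- For a partition λ = (λ_1 ≥ ... ≥ λ_ℓ) we use the alternant definition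
--   [s_λ] f = [x^{λ+δ}] (a_δ · f(x_1,...,x_ℓ)),  δ = (ℓ-1,...,1,0),
--   a_δ = Σ_{σ ∈ S_ℓ} sgn(σ) x^{σ(δ)},
-- i.e.  [s_λ] f = Σ_σ sgn(σ) [x^{λ+δ-σ(δ)}] f.

insertAll : {A : Set} → A → List A → List (List A)
insertAll x []       = (x ∷ []) ∷ []
insertAll x (y ∷ ys) = (x ∷ y ∷ ys) ∷ map (y ∷_) (insertAll x ys)

permutations : {A : Set} → List A → List (List A)
permutations []       = [] ∷ []
permutations (x ∷ xs) = concatMap (insertAll x) (permutations xs)

-- number of inversions w.r.t. the decreasing order (δ itself has 0)
inversions : List ℕ → ℕ
inversions []       = 0
inversions (x ∷ xs) = length (filterᵇ (x <ᵇ_) xs) + inversions xs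

signOf : ℕ → ℤ
signOf zero    = ℤ.1ℤ
signOf (suc k) = ℤ.- signOf k

shifted : List ℕ → List ℕ → List ℕ → Maybe (List ℕ)
shifted (l ∷ ls) (d ∷ ds) (t ∷ ts) with shifted ls ds ts
... | nothing = nothing
... | just r  = if t ≤ᵇ l + d then just ((l + d ∸ t) ∷ r) else nothing
shifted _ _ _ = just []

coeffAt : (List ℕ → ℤ) → Maybe (List ℕ) → ℤ
coeffAt f nothing  = ℤ.0ℤ
coeffAt f (just e) = f e

schurCoeff : (List ℕ → ℤ) → List ℕ → ℤ
schurCoeff f λs =
  foldr ℤ._+_ ℤ.0ℤ
    (map (λ τ → signOf (inversions τ) ℤ.* coeffAt f (shifted λs δ τ)) (permutations δ))
  where δ = downFrom (length λs)

schurCoeffY : ∀ {n} → Graph n → List ℕ → ℤ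
schurCoeffY G λs = schurCoeff (λ a → + YCoeff G a) λs

{-# OPTIONS --safe #-}
-- A proper colouring with two colours is a pair (S , T) of colour classes,
-- and it is proper exactly when S and T are both independent, so the
-- monomial coefficient [x₁ᵃ x₂ᵇ] Y_G equals iₐ i_b.  For a two-row shape the
-- alternant formula has only two terms, [s_(k,k)] f = [x₁ᵏ x₂ᵏ] f − [x₁ᵏ⁺¹ x₂ᵏ⁻¹] f,
-- hence [s_(k,k)] Y_G = i_k² − i_{k+1} i_{k−1}.
module Submission where

open import Defs hiding (sym)
open import Data.Nat using (ℕ; zero; suc; _≤_; _+_; _*_; _∸_; _≡ᵇ_)
open import Data.Integer as ℤ using (0ℤ)
open import Data.List using (_∷_; [])
open import Function.Bundles using (_⇔_)

open import Algebra.Bundles using (CommutativeMonoid)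
open import Data.Bool using (Bool; true; false; _∧_; _∨_; not)
open import Data.Bool.Properties using (∧-identityʳ; ∧-zeroʳ; ∧-commutativeMonoid)
open import Data.Fin using (Fin) renaming (zero to fzero; suc to fsuc)
open import Data.Fin.Subset using (Subset; ∣_∣)
import Data.Integer.Properties as ℤ
open import Data.List as List using (List; map; filterᵇ; length; concatMap)
open import Data.List.Properties using (map-∘)
open import Data.Nat.ListAction using (sum)
open import Data.Nat.Properties using (+-assoc; +-comm; *-comm; +-identityʳ; +-commutativeSemigroup)
open import Data.Vec as Vec using (Vec; lookup; zipWith)
open import Data.Vec.Properties using (lookup-zipWith)
open import Function using (_∘_; mk⇔)
open import Relation.Binary.PropositionalEquality
  using (_≡_; _≗_; refl; sym; trans; cong; cong₂; subst₂; module ≡-Reasoning)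

import Algebra.Properties.CommutativeSemigroup as CommutativeSemigroupProperties
open CommutativeSemigroupProperties +-commutativeSemigroup
  using () renaming (interchange to +-interchange)
open CommutativeSemigroupProperties (CommutativeMonoid.commutativeSemigroup ∧-commutativeMonoid)
  using () renaming (interchange to ∧-interchange)

count : {A : Set} → (A → Bool) → List A → ℕ
count p xs = length (filterᵇ p xs)

module _ {A : Set} where

  count-++ : (p : A → Bool) (xs ys : List A) → count p (xs List.++ ys) ≡ count p xs + count p ys
  count-++ p []       ys = refl
  count-++ p (x ∷ xs) ys with p x
  ... | true  = cong suc (count-++ p xs ys)
  ... | false = count-++ p xs ys

  count-cong : {p q : A → Bool} → p ≗ q → count p ≗ count q
  count-cong         p≗q []       = refl
  count-cong {p} {q} p≗q (x ∷ xs) with p x | q x | p≗q x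
  ... | true  | true  | _ = cong suc (count-cong p≗q xs)
  ... | false | false | _ = count-cong p≗q xs

  count-false : (xs : List A) → count (λ _ → false) xs ≡ 0
  count-false []       = refl
  count-false (_ ∷ xs) = count-false xs

  count-filterᵇ : (p q : A → Bool) (xs : List A) →
                  length (filterᵇ q (filterᵇ p xs)) ≡ count (λ x → p x ∧ q x) xs
  count-filterᵇ p q [] = refl
  count-filterᵇ p q (x ∷ xs) with p x
  ... | false = count-filterᵇ p q xs
  ... | true with q x
  ...   | true  = cong suc (count-filterᵇ p q xs)
  ...   | false = count-filterᵇ p q xs

  sum-map-++ : (f : A → ℕ) (xs ys : List A) →
               sum (map f (xs List.++ ys)) ≡ sum (map f xs) + sum (map f ys)
  sum-map-++ f []       ys = refl
  sum-map-++ f (x ∷ xs) ys = trans (cong (f x +_) (sum-map-++ f xs ys)) (sym (+-assoc (f x) _ _))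

  sum-map-cong : {f g : A → ℕ} → f ≗ g → (xs : List A) → sum (map f xs) ≡ sum (map g xs)
  sum-map-cong f≗g []       = refl
  sum-map-cong f≗g (x ∷ xs) = cong₂ _+_ (f≗g x) (sum-map-cong f≗g xs)

  sum-map-+ : (f g : A → ℕ) (xs : List A) →
              sum (map (λ x → f x + g x) xs) ≡ sum (map f xs) + sum (map g xs)
  sum-map-+ f g []       = refl
  sum-map-+ f g (x ∷ xs) = begin
    f x + g x + sum (map (λ x → f x + g x) xs) ≡⟨ cong (f x + g x +_) (sum-map-+ f g xs) ⟩
    f x + g x + (F + G)                         ≡⟨ +-interchange (f x) (g x) F G ⟩
    f x + F + (g x + G)                         ∎
    where
    open ≡-Reasoning
    F G : ℕ
    F = sum (map f xs)
    G = sum (map g xs)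

module _ {A B : Set} where

  count-map : (p : B → Bool) (f : A → B) (xs : List A) → count p (map f xs) ≡ count (p ∘ f) xs
  count-map p f []       = refl
  count-map p f (x ∷ xs) with p (f x)
  ... | true  = cong suc (count-map p f xs)
  ... | false = count-map p f xs

  count-concatMap : (p : B → Bool) (g : A → List B) (xs : List A) →
                    count p (concatMap g xs) ≡ sum (map (count p ∘ g) xs)
  count-concatMap p g []       = refl
  count-concatMap p g (x ∷ xs) =
    trans (count-++ p (g x) (concatMap g xs)) (cong (count p (g x) +_) (count-concatMap p g xs))

  sum-count-∧ : (q : A → Bool) (r : B → Bool) (xs : List A) (ys : List B) →
                sum (map (λ x → count (λ y → q x ∧ r y) ys) xs) ≡ count q xs * count r ys
  sum-count-∧ q r []       ys = refl
  sum-count-∧ q r (x ∷ xs) ys with q x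
  ... | true  = cong (count r ys +_) (sum-count-∧ q r xs ys)
  ... | false = cong₂ _+_ (count-false ys) (sum-count-∧ q r xs ys)

colourPair : ∀ {n} → Subset n → Subset n → Vec (Subset 2) n
colourPair = zipWith (λ s t → s Vec.∷ t Vec.∷ Vec.[])

count-twoColourings : ∀ n (P : Vec (Subset 2) n → Bool) →
  count P (allVecs (allSubsets 2) n) ≡
  sum (map (λ S → count (P ∘ colourPair S) (allSubsets n)) (allSubsets n))
count-twoColourings zero    P with P Vec.[]
... | true  = refl
... | false = refl
count-twoColourings (suc n) P = begin
  count P (concatMap (λ c → map (c Vec.∷_) K) (allSubsets 2))
    ≡⟨ count-concatMap P (λ c → map (c Vec.∷_) K) (allSubsets 2) ⟩
  sum (map (λ c → count P (map (c Vec.∷_) K)) (allSubsets 2))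
    ≡⟨ sum-map-cong (λ c → trans (count-map P (c Vec.∷_) K) (count-twoColourings n (P ∘ (c Vec.∷_))))
                    (allSubsets 2) ⟩
  F true true + (F true false + (F false true + (F false false + 0)))
    ≡⟨ cong (λ z → F true true + (F true false + (F false true + z))) (+-identityʳ _) ⟩
  F true true + (F true false + (F false true + F false false))
    ≡⟨ sym (+-assoc (F true true) _ _) ⟩
  (F true true + F true false) + (F false true + F false false)
    ≡⟨ cong₂ _+_ (sym (sum-map-+ (G true true) (G true false) A))
                 (sym (sum-map-+ (G false true) (G false false) A)) ⟩
  sum (map (λ S → G true true S + G true false S) A)
    + sum (map (λ S → G false true S + G false false S) A)
    ≡⟨ cong₂ _+_ (sum-map-cong (sym ∘ row true) A) (sum-map-cong (sym ∘ row false) A) ⟩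
  sum (map (H ∘ (true Vec.∷_)) A) + sum (map (H ∘ (false Vec.∷_)) A)
    ≡⟨ cong₂ _+_ (cong sum (map-∘ A)) (cong sum (map-∘ A)) ⟩
  sum (map H (map (true Vec.∷_) A)) + sum (map H (map (false Vec.∷_) A))
    ≡⟨ sym (sum-map-++ H (map (true Vec.∷_) A) (map (false Vec.∷_) A)) ⟩
  sum (map H (allSubsets (suc n)))
    ∎
  where
  open ≡-Reasoning
  K : List (Vec (Subset 2) n)
  K = allVecs (allSubsets 2) n
  A : List (Subset n)
  A = allSubsets n
  G : Bool → Bool → Subset n → ℕ
  G b c S = count (λ T → P ((b Vec.∷ c Vec.∷ Vec.[]) Vec.∷ colourPair S T)) A
  F : Bool → Bool → ℕ
  F b c = sum (map (G b c) A)
  H : Subset (suc n) → ℕ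
  H S = count (P ∘ colourPair S) (allSubsets (suc n))
  row : ∀ b S → H (b Vec.∷ S) ≡ G b true S + G b false S
  row b S = trans (count-++ _ (map (true Vec.∷_) A) (map (false Vec.∷_) A))
                  (cong₂ _+_ (count-map _ (true Vec.∷_) A) (count-map _ (false Vec.∷_) A))

module _ {A : Set} where

  all-cong : {p q : A → Bool} → p ≗ q → all p ≗ all q
  all-cong p≗q []       = refl
  all-cong p≗q (x ∷ xs) = cong₂ _∧_ (p≗q x) (all-cong p≗q xs)

  all-∧ : (p q : A → Bool) (xs : List A) → all (λ x → p x ∧ q x) xs ≡ all p xs ∧ all q xs
  all-∧ p q []       = refl
  all-∧ p q (x ∷ xs) =
    trans (cong ((p x ∧ q x) ∧_) (all-∧ p q xs)) (∧-interchange (p x) (q x) (all p xs) (all q xs))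

edgeCondition-split : ∀ a s s′ t t′ →
  (not a ∨ (not (s ∧ s′) ∧ (not (t ∧ t′) ∧ true))) ≡ (not (s ∧ s′ ∧ a) ∧ not (t ∧ t′ ∧ a))
edgeCondition-split true  s s′ t t′
  rewrite ∧-identityʳ s′ | ∧-identityʳ t′ = cong (not (s ∧ s′) ∧_) (∧-identityʳ _)
edgeCondition-split false s s′ t t′
  rewrite ∧-zeroʳ s′ | ∧-zeroʳ s | ∧-zeroʳ t′ | ∧-zeroʳ t = refl

exponent-colourPair-first : ∀ {n} (S T : Subset n) → exponent (colourPair S T) fzero ≡ ∣ S ∣
exponent-colourPair-first Vec.[]           Vec.[]       = refl
exponent-colourPair-first (true  Vec.∷ S) (_ Vec.∷ T) = cong suc (exponent-colourPair-first S T)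
exponent-colourPair-first (false Vec.∷ S) (_ Vec.∷ T) = exponent-colourPair-first S T

exponent-colourPair-second : ∀ {n} (S T : Subset n) → exponent (colourPair S T) (fsuc fzero) ≡ ∣ T ∣
exponent-colourPair-second Vec.[]       Vec.[]           = refl
exponent-colourPair-second (_ Vec.∷ S) (true  Vec.∷ T) = cong suc (exponent-colourPair-second S T)
exponent-colourPair-second (_ Vec.∷ S) (false Vec.∷ T) = exponent-colourPair-second S T

module _ {n} (G : Graph n) where

  isProper-colourPair : (S T : Subset n) →
                        isProper G (colourPair S T) ≡ isIndependent G S ∧ isIndependent G T
  isProper-colourPair S T =
    trans (all-cong (λ u → trans (all-cong (edge u) V) (all-∧ (avoids S u) (avoids T u) V)) V)
          (all-∧ (λ u → all (avoids S u) V) (λ u → all (avoids T u) V) V)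
    where
    V : List (Fin n)
    V = vertices n
    avoids : Subset n → Fin n → Fin n → Bool
    avoids S u v = not (lookup S u ∧ lookup S v ∧ Adj G u v)
    shareColour : Fin n → Fin n → Fin 2 → Bool
    shareColour u v c = lookup (lookup (colourPair S T) u) c ∧ lookup (lookup (colourPair S T) v) c
    edge : ∀ u v → (not (Adj G u v) ∨ all (not ∘ shareColour u v) (vertices 2))
                   ≡ (avoids S u v ∧ avoids T u v)
    edge u v rewrite lookup-zipWith (λ s t → s Vec.∷ t Vec.∷ Vec.[]) u S T
                   | lookup-zipWith (λ s t → s Vec.∷ t Vec.∷ Vec.[]) v S T
      = edgeCondition-split (Adj G u v) (lookup S u) (lookup S v) (lookup T u) (lookup T v)

  isIndependentOfSize : ℕ → Subset n → Bool
  isIndependentOfSize j S = isIndependent G S ∧ (∣ S ∣ ≡ᵇ j)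

  YCoeff-twoColours : (a b : ℕ) → YCoeff G (a ∷ b ∷ []) ≡ indepCount G a * indepCount G b
  YCoeff-twoColours a b = begin
    YCoeff G (a ∷ b ∷ [])
      ≡⟨ count-twoColourings n hasType ⟩
    sum (map (λ S → count (hasType ∘ colourPair S) A) A)
      ≡⟨ sum-map-cong (λ S → count-cong (hasType-colourPair S) A) A ⟩
    sum (map (λ S → count (λ T → isIndependentOfSize a S ∧ isIndependentOfSize b T) A) A)
      ≡⟨ sum-count-∧ (isIndependentOfSize a) (isIndependentOfSize b) A A ⟩
    count (isIndependentOfSize a) A * count (isIndependentOfSize b) A
      ≡⟨ sym (cong₂ _*_ (count-filterᵇ _ _ A) (count-filterᵇ _ _ A)) ⟩
    indepCount G a * indepCount G b
      ∎
    where
    open ≡-Reasoning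
    A : List (Subset n)
    A = allSubsets n
    hasType : Vec (Subset 2) n → Bool
    hasType κ = isProper G κ ∧ eqVec (Vec.tabulate (exponent κ)) (Vec.fromList (a ∷ b ∷ []))
    hasType-colourPair : ∀ S T →
      hasType (colourPair S T) ≡ isIndependentOfSize a S ∧ isIndependentOfSize b T
    hasType-colourPair S T = begin
      hasType (colourPair S T)
        ≡⟨ cong₂ _∧_ (isProper-colourPair S T)
                     (cong₂ (λ e f → (e ≡ᵇ a) ∧ (f ≡ᵇ b) ∧ true)
                            (exponent-colourPair-first S T) (exponent-colourPair-second S T)) ⟩
      (isIndependent G S ∧ isIndependent G T) ∧ ((∣ S ∣ ≡ᵇ a) ∧ (∣ T ∣ ≡ᵇ b) ∧ true)
        ≡⟨ cong (λ x → (isIndependent G S ∧ isIndependent G T) ∧ ((∣ S ∣ ≡ᵇ a) ∧ x)) (∧-identityʳ _) ⟩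
      (isIndependent G S ∧ isIndependent G T) ∧ ((∣ S ∣ ≡ᵇ a) ∧ (∣ T ∣ ≡ᵇ b))
        ≡⟨ ∧-interchange (isIndependent G S) (isIndependent G T) (∣ S ∣ ≡ᵇ a) (∣ T ∣ ≡ᵇ b) ⟩
      isIndependentOfSize a S ∧ isIndependentOfSize b T
        ∎

schurCoeff-twoRows : (f : List ℕ → ℤ.ℤ) (a b : ℕ) →
  schurCoeff f (suc a ∷ suc b ∷ []) ≡ f (suc a ∷ suc b ∷ []) ℤ.- f (suc (suc a) ∷ b ∷ [])
schurCoeff-twoRows f a b = begin
  schurCoeff f (suc a ∷ suc b ∷ [])
    ≡⟨⟩
  ℤ.1ℤ ℤ.* f (suc a + 1 ∸ 1 ∷ suc b + 0 ∸ 0 ∷ [])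
    ℤ.+ ((ℤ.- ℤ.1ℤ) ℤ.* f (suc a + 1 ∸ 0 ∷ suc b + 0 ∸ 1 ∷ []) ℤ.+ 0ℤ)
    ≡⟨ cong₂ (λ l m → ℤ.1ℤ ℤ.* f l ℤ.+ ((ℤ.- ℤ.1ℤ) ℤ.* f m ℤ.+ 0ℤ))
             (cong₂ (λ x y → x ∷ y ∷ []) (+-comm a 1) (+-identityʳ (suc b)))
             (cong₂ (λ x y → x ∷ y ∷ []) (cong suc (+-comm a 1)) (+-identityʳ b)) ⟩
  ℤ.1ℤ ℤ.* f (suc a ∷ suc b ∷ []) ℤ.+ ((ℤ.- ℤ.1ℤ) ℤ.* f (suc (suc a) ∷ b ∷ []) ℤ.+ 0ℤ)
    ≡⟨ cong₂ ℤ._+_ (ℤ.*-identityˡ (f (suc a ∷ suc b ∷ [])))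
                   (trans (ℤ.+-identityʳ _) (ℤ.-1*i≡-i (f (suc (suc a) ∷ b ∷ [])))) ⟩
  f (suc a ∷ suc b ∷ []) ℤ.- f (suc (suc a) ∷ b ∷ [])
    ∎
  where open ≡-Reasoning

0≤m-n⇔n≤m : (m n : ℕ) → (0ℤ ℤ.≤ ℤ.+ m ℤ.- ℤ.+ n) ⇔ (n ≤ m)
0≤m-n⇔n≤m m n = mk⇔ (ℤ.drop‿+≤+ ∘ ℤ.0≤i-j⇒j≤i) (ℤ.i≤j⇒0≤j-i ∘ ℤ.+≤+)

corollary2p5 : ∀ {n : ℕ} (G : Graph n) (k : ℕ) → 1 ≤ k → k + 1 ≤ independenceNumber G →
    ((0ℤ ℤ.≤ schurCoeffY G (k ∷ k ∷ []))
      ⇔ (indepCount G (k ∸ 1) * indepCount G (k + 1) ≤ indepCount G k * indepCount G k))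
corollary2p5 G (suc k) _ _ =
  subst₂ (λ s m → (0ℤ ℤ.≤ s) ⇔ (i k * i m ≤ i (suc k) * i (suc k)))
         (sym schurCoeff-square) (+-comm 1 (suc k))
         (0≤m-n⇔n≤m (i (suc k) * i (suc k)) (i k * i (suc (suc k))))
  where
  i : ℕ → ℕ
  i = indepCount G
  schurCoeff-square :
    schurCoeffY G (suc k ∷ suc k ∷ []) ≡ ℤ.+ (i (suc k) * i (suc k)) ℤ.- ℤ.+ (i k * i (suc (suc k)))
  schurCoeff-square = trans (schurCoeff-twoRows (λ a → ℤ.+ YCoeff G a) k k)
    (cong₂ (λ x y → ℤ.+ x ℤ.- ℤ.+ y)
           (YCoeff-twoColours G (suc k) (suc k))
           (trans (YCoeff-twoColours G (suc (suc k)) k) (*-comm (i (suc (suc k))) (i k))))
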